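{- Let $D=p_1p_2$ with $p_1\ne p_2$ primes, $p_1\equiv p_2\equiv3\pmod4$, let $\omega_D=(1+\sqrt D)/2$, $Q(X,Y)=(X+Y\omega_D)(X+Y\tilde\omega_D)$, and let $\epsilon_D=x+y\omega_D>1$ ($x,y\in\mathbb Z$) be the fundamental unit of $\mathbb Z[\omega_D]$, which has norm $1$. Then $\gcd(1+x,y)\gcd(1-x,y)=y$, and the two integers \[ Q\Big(\frac{1+x}{\gcd(1+x,y)},\frac{y}{\gcd(1+x,y)}\Big)\quad\text{and}\quad -Q\Big(\frac{x-1}{\gcd(1-x,y)},\frac{y}{\gcd(1-x,y)}\Big) \] are the two prime factors of $D$ (so one may label $p_1,p_2$ so that the first equals $p_1$ and the second equals $p_2$).
   Context: $\tilde\omega_D=(1-\sqrt D)/2$ is the Galois conjugate of $\omega_D$. -}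

module Defs where

open import Data.Nat as ℕ using (ℕ; zero; suc)
open import Data.Integer as ℤ using (ℤ; +_; _+_; _*_; -_; _-_; _<_; _≤_; 0ℤ; 1ℤ; _/ℕ_)
open import Data.Integer.GCD using (gcd)
open import Data.Product using (_×_; _,_; proj₁; proj₂; Σ; ∃)
open import Data.Sum using (_⊎_)
open import Relation.Binary.PropositionalEquality using (_≡_)

-- Elements of Z[ω_D], ω_D = (1+√D)/2, D ≡ 1 (mod 4), written a + b ω_D as pairs (a , b).
Zω : Set
Zω = ℤ × ℤ

-- k = (D-1)/4, so that ω_D² = ω_D + k.
kD : ℕ → ℤ
kD D = + ((D ℕ.∸ 1) ℕ./ 4)

one : Zω
one = (1ℤ , 0ℤ)

-- (a + bω)(c + dω) = (ac + k bd) + (ad + bc + bd) ω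
mul : ℕ → Zω → Zω → Zω
mul D (a , b) (c , d) = (a * c + kD D * (b * d) , a * d + b * c + b * d)

sub : Zω → Zω → Zω
sub (a , b) (c , d) = (a - c , b - d)

-- Galois conjugation: ω̃_D = 1 - ω_D, so a + b ω̃_D = (a + b) - b ω_D.
conj : Zω → Zω
conj (a , b) = (a + b , - b)

-- Norm N(α) = α α̃ (its ω-coordinate is 0).
norm : ℕ → Zω → ℤ
norm D α = proj₁ (mul D α (conj α))

Q : ℕ → ℤ → ℤ → ℤ
Q D X Y = proj₁ (mul D (X , Y) (conj (X , Y)))

IsUnit : ℕ → Zω → Set
IsUnit D α = ∃ λ β → mul D α β ≡ one

-- Real embedding order: a + bω_D = ((2a+b) + b√D)/2.
-- PosSqrt D u v  :⇔  u + v √D > 0  (u, v ∈ ℤ), written without reals.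
PosSqrt : ℕ → ℤ → ℤ → Set
PosSqrt D u v =
    (0ℤ ≤ u × 0ℤ ≤ v × (0ℤ < u ⊎ 0ℤ < v))
  ⊎ (0ℤ < u × v < 0ℤ × (+ D) * (v * v) < u * u)
  ⊎ (u < 0ℤ × 0ℤ < v × u * u < (+ D) * (v * v))

Pos : ℕ → Zω → Set
Pos D (a , b) = PosSqrt D ((+ 2) * a + b) b

_>[_]_ : Zω → ℕ → Zω → Set
α >[ D ] β = Pos D (sub α β)

_≥[_]_ : Zω → ℕ → Zω → Set
α ≥[ D ] β = α >[ D ] β ⊎ α ≡ β

IsFundamentalUnit : ℕ → Zω → Set
IsFundamentalUnit D ε =
  IsUnit D ε × ε >[ D ] one × (∀ η → IsUnit D η → η >[ D ] one → η ≥[ D ] ε)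

-- Exact division of an integer by a nonnegative integer (used only when the
-- divisor is a positive divisor; the value for divisor 0 is an arbitrary convention).
_÷_ : ℤ → ℤ → ℤ
a ÷ (+ zero) = 0ℤ
a ÷ (+ suc n) = a /ℕ suc n
a ÷ ℤ.-[1+ n ] = - (a /ℕ suc n)

{-# OPTIONS --safe #-}
-- Write ε = x + yω, Tr ε = 2x + y and k = (D − 1)/4. As N(ε) = 1 and ε > 1, the element ε − 1 > 0
-- has norm −Tr(ε − 1), which forces Tr ε > 2 and y > 0. For s = ±1 one has (ε + s)² = (Tr ε + 2s) ε
-- and N(ε + s) = s (Tr ε + 2s). Dividing ε + 1 by g₊ = gcd(1 + x, y) and ε − 1 by g₋ = gcd(1 − x, y)
-- gives α₊, α₋ ∈ ℤ[ω] with α₊² = t₊ ε and α₋² = t₋ ε, where t₊ = Q(α₊) and t₋ = −Q(α₋) are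
-- positive. Since (1 + x)(1 − x) = y (x − ky) and 1 = (1 + x) − (x − ky) − ky, we get g₊ g₋ = y,
-- and then (g₊ g₋)² t₊ t₋ = (Tr ε)² − 4 = D y² gives t₊ t₋ = D. Neither factor is 1: otherwise αᵢ
-- would be a unit of norm ±1 with αᵢ² = ε and 1 < αᵢ < ε, against the minimality of ε (the
-- borderline case Tr αᵢ = 1 occurs only for D = 5). Hence {t₊, t₋} = {p₁, p₂}.
module Submission where

open import Defs
open import Data.Nat as ℕ using (ℕ)
open import Data.Nat.Primality using (Prime)
open import Data.Integer as ℤ using (ℤ; +_; _+_; _*_; -_; _-_; 1ℤ)
open import Data.Integer.GCD using (gcd)
open import Data.Product using (_×_; _,_)
open import Data.Sum using (_⊎_)
open import Relation.Binary.PropositionalEquality using (_≡_; _≢_)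

open import Data.Empty using (⊥; ⊥-elim)
open import Data.Integer
  using (-[1+_]; +[1+_]; 0ℤ; -1ℤ; _<_; _≤_; +<+; +≤+; -<+; ∣_∣; _/ℕ_; NonZero; >-nonZero; nonNegative; positive)
open import Data.Integer.Divisibility.Signed
open import Data.Integer.Properties
open import Data.Integer.Tactic.RingSolver using (solve-∀)
import Data.Integer.GCD as ℤ
import Data.Nat.Divisibility as ℕ
import Data.Nat.DivMod as ℕ
import Data.Nat.GCD as ℕ
import Data.Nat.Properties as ℕₚ
open import Data.Nat.Primality using (euclidsLemma; prime⇒irreducible; prime⇒nonZero)
open import Data.Product using (proj₁; proj₂; swap)
open import Data.Sum using (inj₁; inj₂; [_,_])
import Data.Sum
open import Function using (_∘_)
open import Relation.Nullary using (¬_)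
open import Relation.Binary.PropositionalEquality using (refl; sym; trans; cong; cong₂; subst; subst₂; module ≡-Reasoning)

semiprime-factorˡ : ∀ {p q m n} → Prime p → Prime q → p ℕ.∣ m → m ℕ.* n ≡ p ℕ.* q → n ≢ 1 →
                    m ≡ p × n ≡ q
semiprime-factorˡ {p} {q} {m} {n} p-prime q-prime (ℕ.divides c m≡cp) mn≡pq n≢1 = m≡p , n≡q
  where
  instance _ = prime⇒nonZero p-prime
  instance _ = prime⇒nonZero q-prime
  open ≡-Reasoning
  cn≡q : c ℕ.* n ≡ q
  cn≡q = ℕₚ.*-cancelˡ-≡ (c ℕ.* n) q p (begin
    p ℕ.* (c ℕ.* n)   ≡⟨ ℕₚ.*-assoc p c n ⟨
    p ℕ.* c ℕ.* n     ≡⟨ cong (ℕ._* n) (trans (ℕₚ.*-comm p c) (sym m≡cp)) ⟩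
    m ℕ.* n           ≡⟨ mn≡pq ⟩
    p ℕ.* q           ∎)
  n≡q : n ≡ q
  n≡q = [ ⊥-elim ∘ n≢1 , (λ n≡q → n≡q) ] (prime⇒irreducible q-prime (ℕ.divides c (sym cn≡q)))
  m≡p : m ≡ p
  m≡p = trans m≡cp (trans (cong (ℕ._* p) c≡1) (ℕₚ.*-identityˡ p))
    where
    c≡1 : c ≡ 1
    c≡1 = ℕₚ.*-cancelʳ-≡ c 1 q (trans (subst (λ n → c ℕ.* n ≡ q) n≡q cn≡q) (sym (ℕₚ.*-identityˡ q)))

semiprime-factors : ∀ {p q m n} → Prime p → Prime q → m ℕ.* n ≡ p ℕ.* q → m ≢ 1 → n ≢ 1 →
                    (m ≡ p × n ≡ q) ⊎ (m ≡ q × n ≡ p)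
semiprime-factors {p} {q} {m} {n} p-prime q-prime mn≡pq m≢1 n≢1
  with euclidsLemma m n p-prime (ℕ.divides q (trans mn≡pq (ℕₚ.*-comm p q)))
... | inj₁ p∣m = inj₁ (semiprime-factorˡ p-prime q-prime p∣m mn≡pq n≢1)
... | inj₂ p∣n = inj₂ (swap (semiprime-factorˡ p-prime q-prime p∣n (trans (ℕₚ.*-comm n m) mn≡pq) m≢1))

positive-semiprime-factors : ∀ {p q m n} → Prime p → Prime q → 0ℤ < m → 0ℤ < n →
  m * n ≡ + (p ℕ.* q) → m ≢ 1ℤ → n ≢ 1ℤ → (m ≡ + p × n ≡ + q) ⊎ (m ≡ + q × n ≡ + p)
positive-semiprime-factors {m = + m} {+ n} p-prime q-prime _ _ mn≡pq m≢1 n≢1 =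
  Data.Sum.map both both
    (semiprime-factors p-prime q-prime (+-injective (trans (pos-* m n) mn≡pq))
                       (m≢1 ∘ cong (+_)) (n≢1 ∘ cong (+_)))
  where
  both : ∀ {a b c d} → a ≡ b × c ≡ d → + a ≡ + b × + c ≡ + d
  both (a≡b , c≡d) = cong +_ a≡b , cong +_ c≡d
positive-semiprime-factors {m = -[1+ _ ]} _ _ () _ _ _ _
positive-semiprime-factors {m = + _} {n = -[1+ _ ]} _ _ _ () _ _ _

≡1-mod-4⇒≡4k+1 : ∀ D → D ℕ.% 4 ≡ 1 → + D ≡ + 4 * kD D + 1ℤ
≡1-mod-4⇒≡4k+1 D D%4≡1 = trans (cong +_ D≡4k+1) (cong (_+ 1ℤ) (pos-* 4 k))
  where
  open ≡-Reasoning
  q k : ℕ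
  q = D ℕ./ 4
  k = (D ℕ.∸ 1) ℕ./ 4
  D≡1+q*4 : D ≡ 1 ℕ.+ q ℕ.* 4
  D≡1+q*4 = trans (ℕ.m≡m%n+[m/n]*n D 4) (cong (ℕ._+ q ℕ.* 4) D%4≡1)
  D≡4k+1 : D ≡ 4 ℕ.* k ℕ.+ 1
  D≡4k+1 = begin
    D                  ≡⟨ D≡1+q*4 ⟩
    1 ℕ.+ q ℕ.* 4      ≡⟨ ℕₚ.+-comm 1 (q ℕ.* 4) ⟩
    q ℕ.* 4 ℕ.+ 1      ≡⟨ cong (λ n → n ℕ.* 4 ℕ.+ 1) (ℕ.m*n/n≡m q 4) ⟨
    q ℕ.* 4 ℕ./ 4 ℕ.* 4 ℕ.+ 1 ≡⟨ cong (λ n → (n ℕ.∸ 1) ℕ./ 4 ℕ.* 4 ℕ.+ 1) D≡1+q*4 ⟨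
    k ℕ.* 4 ℕ.+ 1      ≡⟨ cong (ℕ._+ 1) (ℕₚ.*-comm k 4) ⟩
    4 ℕ.* k ℕ.+ 1      ∎

a≡b+c*[e-f]⇒a≡b : ∀ {a b e f} c → e ≡ f → a ≡ b + c * (e - f) → a ≡ b
a≡b+c*[e-f]⇒a≡b {a} {b} {e} c refl a≡ = begin
  a                  ≡⟨ a≡ ⟩
  b + c * (e - e)    ≡⟨ cong (λ z → b + c * z) (+-inverseʳ e) ⟩
  b + c * 0ℤ         ≡⟨ cong (λ z → b + z) (*-zeroʳ c) ⟩
  b + 0ℤ             ≡⟨ +-identityʳ b ⟩
  b                  ∎
  where open ≡-Reasoning

0≤i*i : ∀ i → 0ℤ ≤ i * i
0≤i*i (+ n) = subst (0ℤ ≤_) (pos-* n n) (+≤+ ℕ.z≤n)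
0≤i*i -[1+ n ] = +≤+ ℕ.z≤n

0≤i⇒0≤j⇒0≤i*j : ∀ {i j} → 0ℤ ≤ i → 0ℤ ≤ j → 0ℤ ≤ i * j
0≤i⇒0≤j⇒0≤i*j {i} 0≤i 0≤j = subst (_≤ i * _) (*-zeroʳ i) (*-monoˡ-≤-nonNeg i {{nonNegative 0≤i}} 0≤j)

0≤i⇒0<i*j⇒0<j : ∀ {i j} → 0ℤ ≤ i → 0ℤ < i * j → 0ℤ < j
0≤i⇒0<i*j⇒0<j {i} 0≤i 0<i*j =
  *-cancelˡ-<-nonNeg i {{nonNegative 0≤i}} (subst (_< i * _) (sym (*-zeroʳ i)) 0<i*j)

gcd-∣ˡ : ∀ a b → gcd a b ∣ a
gcd-∣ˡ a b = ∣ᵤ⇒∣ (ℤ.gcd[i,j]∣i a b)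

gcd-∣ʳ : ∀ a b → gcd a b ∣ b
gcd-∣ʳ a b = ∣ᵤ⇒∣ (ℤ.gcd[i,j]∣j a b)

*-pres-∣ : ∀ {d₁ d₂ m n} → d₁ ∣ m → d₂ ∣ n → d₁ * d₂ ∣ m * n
*-pres-∣ {d₁} {n = n} d₁∣m d₂∣n = ∣-trans (*-monoʳ-∣ d₁ d₂∣n) (*-monoˡ-∣ n d₁∣m)

gcd*gcd∣ : ∀ {a b c y} u v w → a * b ≡ y * c → u * a + v * c + w * y ≡ 1ℤ →
           gcd a y * gcd b y ∣ y
gcd*gcd∣ {a} {b} {c} {y} u v w ab≡yc bezout =
  subst (G ∣_) y≡ (∣m∣n⇒∣m+n (∣m∣n⇒∣m+n (∣n⇒∣m*n u G∣ay) (∣n⇒∣m*n v G∣yc)) (∣n⇒∣m*n w G∣yy))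
  where
  G : ℤ
  G = gcd a y * gcd b y
  G∣ay : G ∣ a * y
  G∣ay = *-pres-∣ (gcd-∣ˡ a y) (gcd-∣ʳ b y)
  G∣yc : G ∣ y * c
  G∣yc = subst (G ∣_) ab≡yc (*-pres-∣ (gcd-∣ˡ a y) (gcd-∣ˡ b y))
  G∣yy : G ∣ y * y
  G∣yy = *-pres-∣ (gcd-∣ʳ a y) (gcd-∣ʳ b y)
  y≡ : u * (a * y) + v * (y * c) + w * (y * y) ≡ y
  y≡ = trans (identity u v w a c y) (trans (cong (y *_) bezout) (*-identityʳ y))
    where
    identity : ∀ u v w a c y → u * (a * y) + v * (y * c) + w * (y * y) ≡ y * (u * a + v * c + w * y)
    identity = solve-∀

∣gcd*gcd : ∀ {a b y} → y ℕ.∣ a ℕ.* b → y ℕ.∣ ℕ.gcd a y ℕ.* ℕ.gcd b y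
∣gcd*gcd {a} {b} {y} y∣ab = subst (y ℕ.∣_) gcd*gcd≡ (ℕ.gcd-greatest y∣gB*a (ℕ.n∣m*n gB))
  where
  gB : ℕ
  gB = ℕ.gcd b y
  gcd*gcd≡ : ℕ.gcd (gB ℕ.* a) (gB ℕ.* y) ≡ ℕ.gcd a y ℕ.* gB
  gcd*gcd≡ = trans (sym (ℕ.c*gcd[m,n]≡gcd[cm,cn] gB a y)) (ℕₚ.*-comm gB (ℕ.gcd a y))
  y∣gB*a : y ℕ.∣ gB ℕ.* a
  y∣gB*a = subst (y ℕ.∣_) (trans (sym (ℕ.c*gcd[m,n]≡gcd[cm,cn] a b y)) (ℕₚ.*-comm a gB))
                 (ℕ.gcd-greatest y∣ab (ℕ.n∣m*n a))

gcd*gcd≡∣y∣ : ∀ {a b c y} u v w → a * b ≡ y * c → u * a + v * c + w * y ≡ 1ℤ →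
             gcd a y * gcd b y ≡ + ∣ y ∣
gcd*gcd≡∣y∣ {a} {b} {c} {y} u v w ab≡yc bezout =
  trans (sym (pos-* gA gB)) (cong +_ (ℕ.∣-antisym gA*gB∣y y∣gA*gB))
  where
  gA gB : ℕ
  gA = ℕ.gcd ∣ a ∣ ∣ y ∣
  gB = ℕ.gcd ∣ b ∣ ∣ y ∣
  gA*gB∣y : gA ℕ.* gB ℕ.∣ ∣ y ∣
  gA*gB∣y = subst (ℕ._∣ ∣ y ∣) (abs-* (+ gA) (+ gB)) (∣⇒∣ᵤ (gcd*gcd∣ u v w ab≡yc bezout))
  ∣a∣*∣b∣≡∣c∣*∣y∣ : ∣ a ∣ ℕ.* ∣ b ∣ ≡ ∣ c ∣ ℕ.* ∣ y ∣
  ∣a∣*∣b∣≡∣c∣*∣y∣ = trans (sym (abs-* a b)) (trans (cong ∣_∣ ab≡yc) (trans (abs-* y c) (ℕₚ.*-comm ∣ y ∣ ∣ c ∣)))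
  y∣gA*gB : ∣ y ∣ ℕ.∣ gA ℕ.* gB
  y∣gA*gB = ∣gcd*gcd {∣ a ∣} {∣ b ∣} (ℕ.divides ∣ c ∣ ∣a∣*∣b∣≡∣c∣*∣y∣)

[q*d]/ℕd≡q : ∀ q d .{{_ : ℕ.NonZero d}} → (q * + d) /ℕ d ≡ q
[q*d]/ℕd≡q (+ m) d = trans (cong (_/ℕ d) (sym (pos-* m d))) (cong +_ (ℕ.m*n/n≡m m d))
[q*d]/ℕd≡q -[1+ m ] (ℕ.suc d) with ℕ.suc m ℕ.* ℕ.suc d ℕ.% ℕ.suc d | ℕ.m*n%n≡0 (ℕ.suc m) (ℕ.suc d)
... | .0 | refl = cong (-_ ∘ +_) (ℕ.m*n/n≡m (ℕ.suc m) (ℕ.suc d))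

g*[a÷g]≡a : ∀ {a g} → 0ℤ < g → g ∣ a → g * (a ÷ g) ≡ a
g*[a÷g]≡a {g = + ℕ.suc n} _ (divides q refl) =
  trans (*-comm (+ ℕ.suc n) _) (cong (_* + ℕ.suc n) ([q*d]/ℕd≡q q (ℕ.suc n)))
g*[a÷g]≡a {g = + ℕ.zero} (+<+ ()) _

0<gcd : ∀ a {b} → 0ℤ < b → 0ℤ < gcd a b
0<gcd a {+[1+ n ]} _ = +<+ (ℕₚ.n≢0⇒n>0 (ℕ.gcd[m,n]≢0 ∣ a ∣ (ℕ.suc n) (inj₂ λ ())))
0<gcd _ {+ 0} (+<+ ())

tr : Zω → ℤ
tr (a , b) = + 2 * a + b

infixr 8 _·_
_·_ : ℤ → Zω → Zω
c · (a , b) = c * a , c * b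

·-cancel : ∀ c {α β} .{{_ : NonZero c}} → c · α ≡ c · β → α ≡ β
·-cancel c {_ , _} {_ , _} c·α≡c·β =
  cong₂ _,_ (*-cancelˡ-≡ c _ _ (cong proj₁ c·α≡c·β)) (*-cancelˡ-≡ c _ _ (cong proj₂ c·α≡c·β))

·-÷ : ∀ {a b g} → 0ℤ < g → g ∣ a → g ∣ b → g · (a ÷ g , b ÷ g) ≡ (a , b)
·-÷ 0<g g∣a g∣b = cong₂ _,_ (g*[a÷g]≡a 0<g g∣a) (g*[a÷g]≡a 0<g g∣b)

tr-· : ∀ c α → tr (c · α) ≡ c * tr α
tr-· c (a , b) = identity c a b
  where
  identity : ∀ c a b → + 2 * (c * a) + c * b ≡ c * (+ 2 * a + b)
  identity = solve-∀

norm-· : ∀ D c α → norm D (c · α) ≡ c * c * norm D α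
norm-· D c (a , b) = identity c a b (kD D)
  where
  identity : ∀ c a b k →
    c * a * (c * a + c * b) + k * (c * b * - (c * b)) ≡ c * c * (a * (a + b) + k * (b * - b))
  identity = solve-∀

mul-· : ∀ D c d α β → mul D (c · α) (d · β) ≡ (c * d) · mul D α β
mul-· D c d (a , b) (a′ , b′) = cong₂ _,_ (identity₁ c d a b a′ b′ (kD D)) (identity₂ c d a b a′ b′)
  where
  identity₁ : ∀ c d a b a′ b′ k →
    c * a * (d * a′) + k * (c * b * (d * b′)) ≡ c * d * (a * a′ + k * (b * b′))
  identity₁ = solve-∀
  identity₂ : ∀ c d a b a′ b′ →
    c * a * (d * b′) + c * b * (d * a′) + c * b * (d * b′) ≡ c * d * (a * b′ + b * a′ + b * b′)
  identity₂ = solve-∀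

mul-·-conj : ∀ D c α → mul D α (c · conj α) ≡ (c * norm D α , 0ℤ)
mul-·-conj D c (a , b) = cong₂ _,_ (identity₁ c a b (kD D)) (identity₂ c a b)
  where
  identity₁ : ∀ c a b k → a * (c * (a + b)) + k * (b * (c * - b)) ≡ c * (a * (a + b) + k * (b * - b))
  identity₁ = solve-∀
  identity₂ : ∀ c a b → a * (c * - b) + b * (c * (a + b)) + b * (c * - b) ≡ 0ℤ
  identity₂ = solve-∀

tr*tr≡D*b*b+4*norm : ∀ {D} → + D ≡ + 4 * kD D + 1ℤ → ∀ a b →
                     tr (a , b) * tr (a , b) ≡ + D * (b * b) + + 4 * norm D (a , b)
tr*tr≡D*b*b+4*norm {D} D≡4k+1 a b =
  trans (identity a b (kD D)) (cong (λ d → d * (b * b) + + 4 * norm D (a , b)) (sym D≡4k+1))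
  where
  identity : ∀ a b k → (+ 2 * a + b) * (+ 2 * a + b)
                     ≡ (+ 4 * k + 1ℤ) * (b * b) + + 4 * (a * (a + b) + k * (b * - b))
  identity = solve-∀

tr-shift : ∀ x y s → tr (x + s , y) ≡ tr (x , y) + + 2 * s
tr-shift = identity
  where
  identity : ∀ x y s → + 2 * (x + s) + y ≡ + 2 * x + y + + 2 * s
  identity = solve-∀

norm-shift : ∀ D x y s → s * s ≡ norm D (x , y) → norm D (x + s , y) ≡ s * (tr (x , y) + + 2 * s)
norm-shift D x y s s*s≡Nε = a≡b+c*[e-f]⇒a≡b -1ℤ s*s≡Nε (identity x y s (kD D))
  where
  identity : ∀ x y s k → (x + s) * (x + s + y) + k * (y * - y)
                       ≡ s * (+ 2 * x + y + + 2 * s) + -1ℤ * (s * s - (x * (x + y) + k * (y * - y)))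
  identity = solve-∀

square-shift : ∀ D x y s → s * s ≡ norm D (x , y) →
               mul D (x + s , y) (x + s , y) ≡ (tr (x , y) + + 2 * s) · (x , y)
square-shift D x y s s*s≡Nε =
  cong₂ _,_ (a≡b+c*[e-f]⇒a≡b 1ℤ s*s≡Nε (identity₁ x y s (kD D))) (identity₂ x y s)
  where
  identity₁ : ∀ x y s k → (x + s) * (x + s) + k * (y * y)
                        ≡ (+ 2 * x + y + + 2 * s) * x + 1ℤ * (s * s - (x * (x + y) + k * (y * - y)))
  identity₁ = solve-∀
  identity₂ : ∀ x y s → (x + s) * y + y * (x + s) + y * y ≡ (+ 2 * x + y + + 2 * s) * y
  identity₂ = solve-∀

PosSqrt⇒positive : ∀ {D w v} → 1 ℕ.≤ D → w * w + + 4 * w ≡ + D * (v * v) → PosSqrt D w v →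
                   0ℤ < w × 0ℤ < v
PosSqrt⇒positive {w = +[1+ _ ]} {+[1+ _ ]} _ _ (inj₁ _) = +<+ (ℕ.s≤s ℕ.z≤n) , +<+ (ℕ.s≤s ℕ.z≤n)
PosSqrt⇒positive {D} {+[1+ _ ]} {+ 0} _ eq (inj₁ _) with trans eq (*-zeroʳ (+ D))
... | ()
PosSqrt⇒positive {w = + 0} {+[1+ _ ]} (ℕ.s≤s _) () (inj₁ _)
PosSqrt⇒positive {w = + 0} {+ 0} _ _ (inj₁ (_ , _ , inj₁ (+<+ ())))
PosSqrt⇒positive {w = + 0} {+ 0} _ _ (inj₁ (_ , _ , inj₂ (+<+ ())))
PosSqrt⇒positive {w = w@(+[1+ _ ])} _ eq (inj₂ (inj₁ (_ , _ , Dv²<w²))) =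
  ⊥-elim (≤⇒≯ (i≤i+j (w * w) (+ 4 * w)) (subst (_< w * w) (sym eq) Dv²<w²))
PosSqrt⇒positive {w = w@(-[1+ _ ])} _ eq (inj₂ (inj₂ (_ , _ , w²<Dv²))) =
  ⊥-elim (≤⇒≯ (i-j≤i (w * w) (- (+ 4 * w))) (subst (w * w <_) (sym eq) w²<Dv²))
PosSqrt⇒positive {w = + 0} _ _ (inj₂ (inj₁ (+<+ () , _)))
PosSqrt⇒positive {w = + _} _ _ (inj₂ (inj₂ (+<+ () , _)))

Pos∧norm≡-tr⇒positive : ∀ {D} → + D ≡ + 4 * kD D + 1ℤ → 1 ℕ.≤ D → ∀ a b → Pos D (a , b) →
                        norm D (a , b) ≡ - tr (a , b) → 0ℤ < tr (a , b) × 0ℤ < b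
Pos∧norm≡-tr⇒positive {D} D≡4k+1 1≤D a b β>0 N≡-tr = PosSqrt⇒positive 1≤D w*w+4w≡Dv*v β>0
  where
  open ≡-Reasoning
  w : ℤ
  w = tr (a , b)
  w*w+4w≡Dv*v : w * w + + 4 * w ≡ + D * (b * b)
  w*w+4w≡Dv*v = begin
    w * w + + 4 * w                              ≡⟨ cong (_+ + 4 * w) (tr*tr≡D*b*b+4*norm D≡4k+1 a b) ⟩
    + D * (b * b) + + 4 * norm D (a , b) + + 4 * w ≡⟨ cong (λ n → + D * (b * b) + + 4 * n + + 4 * w) N≡-tr ⟩
    + D * (b * b) + + 4 * - w + + 4 * w          ≡⟨ identity (+ D * (b * b)) w ⟩
    + D * (b * b)                                ∎
    where
    identity : ∀ p w → p + + 4 * - w + + 4 * w ≡ p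
    identity = solve-∀

1<tr⇒>one : ∀ {D} a b → 0ℤ < b → 1ℤ < tr (a , b) → (a , b) >[ D ] one
1<tr⇒>one a b 0<b 1<tr = inj₁ (subst (0ℤ ≤_) (sym (identity a b)) (i≤j⇒0≤j-i (i<j⇒suc[i]≤j 1<tr))
                              , subst (0ℤ ≤_) (sym (+-identityʳ b)) (<⇒≤ 0<b)
                              , inj₂ (subst (0ℤ <_) (sym (+-identityʳ b)) 0<b))
  where
  identity : ∀ a b → + 2 * (a - 1ℤ) + (b - 0ℤ) ≡ + 2 * a + b - + 2
  identity = solve-∀

square-above-root : ∀ {D} a b → 0ℤ < b → 1ℤ < tr (a , b) → ¬ ((a , b) ≥[ D ] mul D (a , b) (a , b))
square-above-root {D} a b 0<b 1<tr = refute
  where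
  x y : ℤ
  x = a * a + kD D * (b * b)
  y = a * b + b * a + b * b
  y≡b*tr : y ≡ b * tr (a , b)
  y≡b*tr = identity a b
    where
    identity : ∀ a b → a * b + b * a + b * b ≡ b * (+ 2 * a + b)
    identity = solve-∀
  b<y : b < y
  b<y = subst₂ _<_ (*-identityʳ b) (sym y≡b*tr) (*-monoˡ-<-pos b {{positive 0<b}} 1<tr)
  tr≤tr[α²] : tr (a , b) ≤ + 2 * x + y
  tr≤tr[α²] = begin
    tr (a , b)       ≡⟨ *-identityˡ (tr (a , b)) ⟨
    1ℤ * tr (a , b)  ≤⟨ *-monoʳ-≤-nonNeg (tr (a , b)) {{nonNegative 0≤tr}} (i<j⇒suc[i]≤j 0<b) ⟩
    b * tr (a , b)   ≡⟨ y≡b*tr ⟨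
    y                ≤⟨ i≤j+i y (+ 2 * x) {{nonNegative 0≤2x}} ⟩
    + 2 * x + y      ∎
    where
    open ≤-Reasoning
    0≤tr : 0ℤ ≤ tr (a , b)
    0≤tr = <⇒≤ (<-trans (+<+ (ℕ.s≤s ℕ.z≤n)) 1<tr)
    0≤2x : 0ℤ ≤ + 2 * x
    0≤2x = 0≤i⇒0≤j⇒0≤i*j {+ 2} (+≤+ ℕ.z≤n)
             (+-mono-≤ (0≤i*i a) (0≤i⇒0≤j⇒0≤i*j {kD D} (+≤+ ℕ.z≤n) (0≤i*i b)))
  y≤b⇒⊥ : y ≤ b → ⊥
  y≤b⇒⊥ = <⇒≱ b<y
  refute : (a , b) ≥[ D ] (x , y) → ⊥
  refute (inj₂ α≡α²) = <-irrefl (cong proj₂ α≡α²) b<y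
  refute (inj₁ (inj₁ (_ , 0≤b-y , _))) = y≤b⇒⊥ (0≤i-j⇒j≤i 0≤b-y)
  refute (inj₁ (inj₂ (inj₂ (_ , 0<b-y , _)))) = y≤b⇒⊥ (0≤i-j⇒j≤i (<⇒≤ 0<b-y))
  refute (inj₁ (inj₂ (inj₁ (0<u , _ , _)))) =
    ≤⇒≯ (i≤j⇒i-j≤0 tr≤tr[α²]) (subst (0ℤ <_) (identity a b x y) 0<u)
    where
    identity : ∀ a b x y → + 2 * (a - x) + (b - y) ≡ (+ 2 * a + b) - (+ 2 * x + y)
    identity = solve-∀

norm≡±1⇒IsUnit : ∀ {D} α → norm D α ≡ 1ℤ ⊎ norm D α ≡ -1ℤ → IsUnit D α
norm≡±1⇒IsUnit {D} α N≡±1 =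
  norm D α · conj α , trans (mul-·-conj D (norm D α) α) (cong (_, 0ℤ) ([ cong square , cong square ] N≡±1))
  where
  square : ℤ → ℤ
  square n = n * n

norm≡±1⇒tr≢1 : ∀ {D} → + D ≡ + 4 * kD D + 1ℤ → 5 ℕ.< D → ∀ a b →
               norm D (a , b) ≡ 1ℤ ⊎ norm D (a , b) ≡ -1ℤ → 0ℤ < b → tr (a , b) ≢ 1ℤ
norm≡±1⇒tr≢1 {D} D≡4k+1 (ℕ.s≤s (ℕ.s≤s (ℕ.s≤s (ℕ.s≤s (ℕ.s≤s (ℕ.s≤s _)))))) a b@(+[1+ _ ]) N≡±1 _ tr≡1 =
  [ (λ N≡1 → 1≢b*b*D+4 (subst (λ n → 1ℤ ≡ b * b * + D + + 4 * n) N≡1 1≡b*b*D+4*N))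
  , (λ N≡-1 → 1≢b*b*D-4 (subst (λ n → 1ℤ ≡ b * b * + D + + 4 * n) N≡-1 1≡b*b*D+4*N)) ] N≡±1
  where
  -- With D as the right factor, ℕ multiplication exposes the six successors of D, so both
  -- equations 1 = b² D ± 4 below are refuted by computation.
  1≡b*b*D+4*N : 1ℤ ≡ b * b * + D + + 4 * norm D (a , b)
  1≡b*b*D+4*N = trans (cong (λ t → t * t) (sym tr≡1))
                      (trans (tr*tr≡D*b*b+4*norm D≡4k+1 a b)
                             (cong (_+ + 4 * norm D (a , b)) (*-comm (+ D) (b * b))))
  1≢b*b*D+4 : 1ℤ ≢ b * b * + D + + 4 * 1ℤ
  1≢b*b*D+4 ()
  1≢b*b*D-4 : 1ℤ ≢ b * b * + D + + 4 * -1ℤ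
  1≢b*b*D-4 ()
norm≡±1⇒tr≢1 _ _ _ (+ 0) _ (+<+ ())

square-not-fundamental : ∀ {D} → + D ≡ + 4 * kD D + 1ℤ → 5 ℕ.< D → ∀ a b →
                         norm D (a , b) ≡ 1ℤ ⊎ norm D (a , b) ≡ -1ℤ → 0ℤ < b → 0ℤ < tr (a , b) →
                         ¬ IsFundamentalUnit D (mul D (a , b) (a , b))
square-not-fundamental {D} D≡4k+1 5<D a b N≡±1 0<b 0<tr (_ , _ , minimal) =
  square-above-root {D} a b 0<b 1<tr
    (minimal (a , b) (norm≡±1⇒IsUnit {D} (a , b) N≡±1) (1<tr⇒>one {D} a b 0<b 1<tr))
  where
  1<tr : 1ℤ < tr (a , b)
  1<tr = ≤∧≢⇒< (i<j⇒suc[i]≤j 0<tr) (norm≡±1⇒tr≢1 D≡4k+1 5<D a b N≡±1 0<b ∘ sym)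

quotient-product : ∀ {T y d g₁ g₂ t₁ t₂} → 0ℤ < y → T * T ≡ d * (y * y) + + 4 → g₁ * g₂ ≡ y →
                   g₁ * g₁ * t₁ ≡ T + + 2 → g₂ * g₂ * t₂ ≡ T - + 2 → t₁ * t₂ ≡ d
quotient-product {T} {y} {d} {g₁} {g₂} {t₁} {t₂} 0<y T*T≡ g₁*g₂≡y g₁*g₁*t₁≡ g₂*g₂*t₂≡ =
  *-cancelˡ-≡ (y * y) (t₁ * t₂) d (begin
    y * y * (t₁ * t₂)                        ≡⟨ cong (λ g → g * g * (t₁ * t₂)) g₁*g₂≡y ⟨
    g₁ * g₂ * (g₁ * g₂) * (t₁ * t₂)          ≡⟨ regroup g₁ g₂ t₁ t₂ ⟩
    g₁ * g₁ * t₁ * (g₂ * g₂ * t₂)            ≡⟨ cong₂ _*_ g₁*g₁*t₁≡ g₂*g₂*t₂≡ ⟩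
    (T + + 2) * (T - + 2)                    ≡⟨ difference-of-squares T ⟩
    T * T - + 4                              ≡⟨ cong (_- + 4) T*T≡ ⟩
    d * (y * y) + + 4 - + 4                  ≡⟨ cancel d (y * y) ⟩
    y * y * d                                ∎)
  where
  open ≡-Reasoning
  instance
    _ = >-nonZero 0<y
    _ = i*j≢0 y y
  regroup : ∀ a b c d → a * b * (a * b) * (c * d) ≡ a * a * c * (b * b * d)
  regroup = solve-∀
  difference-of-squares : ∀ t → (t + + 2) * (t - + 2) ≡ t * t - + 4
  difference-of-squares = solve-∀
  cancel : ∀ d z → d * z + + 4 - + 4 ≡ z * d
  cancel = solve-∀

module FundamentalUnit {D : ℕ} (D≡4k+1 : + D ≡ + 4 * kD D + 1ℤ) (5<D : 5 ℕ.< D) {x y : ℤ}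
                       (ε-fundamental : IsFundamentalUnit D (x , y)) (Nε≡1 : norm D (x , y) ≡ 1ℤ) where

  open ≡-Reasoning

  s*s≡Nε : ∀ {s} → s ≡ 1ℤ ⊎ s ≡ -1ℤ → s * s ≡ norm D (x , y)
  s*s≡Nε s≡±1 = trans ([ cong square , cong square ] s≡±1) (sym Nε≡1)
    where
    square : ℤ → ℤ
    square n = n * n

  0<tr[ε-1]×0<y : 0ℤ < tr (x , y) - + 2 × 0ℤ < y
  0<tr[ε-1]×0<y = subst (λ t → 0ℤ < t × 0ℤ < y) (tr-shift x y -1ℤ)
    (Pos∧norm≡-tr⇒positive D≡4k+1 (ℕₚ.≤-trans (ℕ.s≤s ℕ.z≤n) 5<D) (x - 1ℤ) y ε-1>0 N[ε-1]≡-tr)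
    where
    ε-1>0 : Pos D (x - 1ℤ , y)
    ε-1>0 = subst (λ b → Pos D (x - 1ℤ , b)) (+-identityʳ y) (proj₁ (proj₂ ε-fundamental))
    N[ε-1]≡-tr : norm D (x - 1ℤ , y) ≡ - tr (x - 1ℤ , y)
    N[ε-1]≡-tr = begin
      norm D (x - 1ℤ , y)               ≡⟨ norm-shift D x y -1ℤ (s*s≡Nε (inj₂ refl)) ⟩
      -1ℤ * (tr (x , y) + + 2 * -1ℤ)    ≡⟨ -1*i≡-i _ ⟩
      - (tr (x , y) + + 2 * -1ℤ)        ≡⟨ cong -_ (tr-shift x y -1ℤ) ⟨
      - tr (x - 1ℤ , y)                 ∎

  0<y : 0ℤ < y
  0<y = proj₂ 0<tr[ε-1]×0<y

  0<tr[ε+s] : ∀ {s} → s ≡ 1ℤ ⊎ s ≡ -1ℤ → 0ℤ < tr (x , y) + + 2 * s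
  0<tr[ε+s] (inj₁ refl) = <-trans (proj₁ 0<tr[ε-1]×0<y) (+-monoʳ-< (tr (x , y)) -<+)
  0<tr[ε+s] (inj₂ refl) = proj₁ 0<tr[ε-1]×0<y

  module _ {s t : ℤ} (g : ℤ) (α : Zω) (s≡±1 : s ≡ 1ℤ ⊎ s ≡ -1ℤ) (g·α≡ε+s : g · α ≡ (x + s , y))
           (t≡s*Nα : t ≡ s * norm D α) where

    g*g*t≡tr[ε+s] : g * g * t ≡ tr (x , y) + + 2 * s
    g*g*t≡tr[ε+s] = begin
      g * g * t                               ≡⟨ cong (g * g *_) t≡s*Nα ⟩
      g * g * (s * norm D α)                  ≡⟨ regroup g s (norm D α) ⟩
      s * (g * g * norm D α)                  ≡⟨ cong (s *_) (norm-· D g α) ⟨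
      s * norm D (g · α)                      ≡⟨ cong (λ β → s * norm D β) g·α≡ε+s ⟩
      s * norm D (x + s , y)                  ≡⟨ cong (s *_) (norm-shift D x y s (s*s≡Nε s≡±1)) ⟩
      s * (s * (tr (x , y) + + 2 * s))        ≡⟨ *-assoc s s _ ⟨
      s * s * (tr (x , y) + + 2 * s)          ≡⟨ cong (_* (tr (x , y) + + 2 * s)) (trans (s*s≡Nε s≡±1) Nε≡1) ⟩
      1ℤ * (tr (x , y) + + 2 * s)             ≡⟨ *-identityˡ _ ⟩
      tr (x , y) + + 2 * s                    ∎
      where
      regroup : ∀ g s n → g * g * (s * n) ≡ s * (g * g * n)
      regroup = solve-∀

    0<t : 0ℤ < t
    0<t = 0≤i⇒0<i*j⇒0<j (0≤i*i g) (subst (0ℤ <_) (sym g*g*t≡tr[ε+s]) (0<tr[ε+s] s≡±1))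

    t≢1 : 0ℤ < g → t ≢ 1ℤ
    t≢1 0<g t≡1 =
      square-not-fundamental D≡4k+1 5<D (proj₁ α) (proj₂ α) Nα≡±1 0<b 0<trα
        (subst (IsFundamentalUnit D) (sym α²≡ε) ε-fundamental)
      where
      instance
        _ = >-nonZero 0<g
        _ = i*j≢0 g g
      Nα≡s : norm D α ≡ s
      Nα≡s = begin
        norm D α                ≡⟨ *-identityˡ (norm D α) ⟨
        1ℤ * norm D α           ≡⟨ cong (_* norm D α) (trans (s*s≡Nε s≡±1) Nε≡1) ⟨
        s * s * norm D α        ≡⟨ *-assoc s s (norm D α) ⟩
        s * (s * norm D α)      ≡⟨ cong (s *_) (trans (sym t≡s*Nα) t≡1) ⟩
        s * 1ℤ                  ≡⟨ *-identityʳ s ⟩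
        s                       ∎
      Nα≡±1 : norm D α ≡ 1ℤ ⊎ norm D α ≡ -1ℤ
      Nα≡±1 = Data.Sum.map (trans Nα≡s) (trans Nα≡s) s≡±1
      α²≡ε : mul D α α ≡ (x , y)
      α²≡ε = ·-cancel (g * g) (begin
        (g * g) · mul D α α                   ≡⟨ mul-· D g g α α ⟨
        mul D (g · α) (g · α)                 ≡⟨ cong (λ β → mul D β β) g·α≡ε+s ⟩
        mul D (x + s , y) (x + s , y)         ≡⟨ square-shift D x y s (s*s≡Nε s≡±1) ⟩
        (tr (x , y) + + 2 * s) · (x , y)      ≡⟨ cong (_· (x , y)) g*g*t≡tr[ε+s] ⟨
        (g * g * t) · (x , y)                 ≡⟨ cong (λ t → (g * g * t) · (x , y)) t≡1 ⟩
        (g * g * 1ℤ) · (x , y)                ≡⟨ cong (_· (x , y)) (*-identityʳ (g * g)) ⟩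
        (g * g) · (x , y)                     ∎)
      0<b : 0ℤ < proj₂ α
      0<b = 0≤i⇒0<i*j⇒0<j (<⇒≤ 0<g) (subst (0ℤ <_) (sym (cong proj₂ g·α≡ε+s)) 0<y)
      0<trα : 0ℤ < tr α
      0<trα = 0≤i⇒0<i*j⇒0<j (<⇒≤ 0<g) (subst (0ℤ <_) g*trα≡ (0<tr[ε+s] s≡±1))
        where
        g*trα≡ : tr (x , y) + + 2 * s ≡ g * tr α
        g*trα≡ = begin
          tr (x , y) + + 2 * s    ≡⟨ tr-shift x y s ⟨
          tr (x + s , y)          ≡⟨ cong tr g·α≡ε+s ⟨
          tr (g · α)              ≡⟨ tr-· g α ⟩
          g * tr α                ∎

  gcd*gcd≡y : gcd (1ℤ + x) y * gcd (1ℤ - x) y ≡ y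
  gcd*gcd≡y = trans (gcd*gcd≡∣y∣ {1ℤ + x} {1ℤ - x} {x - kD D * y} 1ℤ -1ℤ (- kD D)
                                  [1+x]*[1-x]≡y*[x-ky] (bezout x y (kD D)))
                    (0≤i⇒+∣i∣≡i (<⇒≤ 0<y))
    where
    [1+x]*[1-x]≡y*[x-ky] : (1ℤ + x) * (1ℤ - x) ≡ y * (x - kD D * y)
    [1+x]*[1-x]≡y*[x-ky] = a≡b+c*[e-f]⇒a≡b -1ℤ Nε≡1 (identity x y (kD D))
      where
      identity : ∀ x y k → (1ℤ + x) * (1ℤ - x)
                         ≡ y * (x - k * y) + -1ℤ * (x * (x + y) + k * (y * - y) - 1ℤ)
      identity = solve-∀
    bezout : ∀ x y k → 1ℤ * (1ℤ + x) + -1ℤ * (x - k * y) + - k * y ≡ 1ℤ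
    bezout = solve-∀

  g₊ g₋ : ℤ
  g₊ = gcd (1ℤ + x) y
  g₋ = gcd (1ℤ - x) y

  α₊ : Zω
  α₊ = (1ℤ + x) ÷ g₊ , y ÷ g₊

  α₋ : Zω
  α₋ = (x - 1ℤ) ÷ g₋ , y ÷ g₋

  g₊·α₊≡ε+1 : g₊ · α₊ ≡ (x + 1ℤ , y)
  g₊·α₊≡ε+1 = trans (·-÷ (0<gcd (1ℤ + x) 0<y) (gcd-∣ˡ (1ℤ + x) y) (gcd-∣ʳ (1ℤ + x) y))
                    (cong (_, y) (+-comm 1ℤ x))

  g₋·α₋≡ε-1 : g₋ · α₋ ≡ (x - 1ℤ , y)
  g₋·α₋≡ε-1 = ·-÷ {x - 1ℤ} (0<gcd (1ℤ - x) 0<y)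
                  (subst (g₋ ∣_) (neg-[1-x] x) (∣m⇒∣-m (gcd-∣ˡ (1ℤ - x) y))) (gcd-∣ʳ (1ℤ - x) y)
    where
    neg-[1-x] : ∀ x → - (1ℤ - x) ≡ x - 1ℤ
    neg-[1-x] = solve-∀

  t₊ t₋ : ℤ
  t₊ = norm D α₊
  t₋ = - norm D α₋

  t₊≡1*N : t₊ ≡ 1ℤ * norm D α₊
  t₊≡1*N = sym (*-identityˡ t₊)

  t₋≡-1*N : t₋ ≡ -1ℤ * norm D α₋
  t₋≡-1*N = sym (-1*i≡-i (norm D α₋))

  t₊*t₋≡D : t₊ * t₋ ≡ + D
  t₊*t₋≡D = quotient-product {tr (x , y)} {g₁ = g₊} {g₂ = g₋} 0<y trε*trε≡ gcd*gcd≡y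
    (g*g*t≡tr[ε+s] g₊ α₊ (inj₁ refl) g₊·α₊≡ε+1 t₊≡1*N)
    (g*g*t≡tr[ε+s] g₋ α₋ (inj₂ refl) g₋·α₋≡ε-1 t₋≡-1*N)
    where
    trε*trε≡ : tr (x , y) * tr (x , y) ≡ + D * (y * y) + + 4
    trε*trε≡ = trans (tr*tr≡D*b*b+4*norm D≡4k+1 x y) (cong (λ n → + D * (y * y) + + 4 * n) Nε≡1)

  0<t₊ : 0ℤ < t₊
  0<t₊ = 0<t g₊ α₊ (inj₁ refl) g₊·α₊≡ε+1 t₊≡1*N

  0<t₋ : 0ℤ < t₋
  0<t₋ = 0<t g₋ α₋ (inj₂ refl) g₋·α₋≡ε-1 t₋≡-1*N

  t₊≢1 : t₊ ≢ 1ℤ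
  t₊≢1 = t≢1 g₊ α₊ (inj₁ refl) g₊·α₊≡ε+1 t₊≡1*N (0<gcd (1ℤ + x) 0<y)

  t₋≢1 : t₋ ≢ 1ℤ
  t₋≢1 = t≢1 g₋ α₋ (inj₂ refl) g₋·α₋≡ε-1 t₋≡-1*N (0<gcd (1ℤ - x) 0<y)

lemma4p10 : (p₁ p₂ : ℕ) → Prime p₁ → Prime p₂ → p₁ ≢ p₂ →
    p₁ ℕ.% 4 ≡ 3 → p₂ ℕ.% 4 ≡ 3 →
    (x y : ℤ) → IsFundamentalUnit (p₁ ℕ.* p₂) (x , y) →
    norm (p₁ ℕ.* p₂) (x , y) ≡ 1ℤ →
    (gcd (1ℤ + x) y * gcd (1ℤ - x) y ≡ y)
    × ((Q (p₁ ℕ.* p₂) ((1ℤ + x) ÷ gcd (1ℤ + x) y) (y ÷ gcd (1ℤ + x) y) ≡ + p₁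
        × - Q (p₁ ℕ.* p₂) ((x - 1ℤ) ÷ gcd (1ℤ - x) y) (y ÷ gcd (1ℤ - x) y) ≡ + p₂)
      ⊎ (Q (p₁ ℕ.* p₂) ((1ℤ + x) ÷ gcd (1ℤ + x) y) (y ÷ gcd (1ℤ + x) y) ≡ + p₂
        × - Q (p₁ ℕ.* p₂) ((x - 1ℤ) ÷ gcd (1ℤ - x) y) (y ÷ gcd (1ℤ - x) y) ≡ + p₁))
lemma4p10 p₁ p₂ p₁-prime p₂-prime _ p₁%4≡3 p₂%4≡3 x y ε-fundamental Nε≡1 =
  gcd*gcd≡y , positive-semiprime-factors p₁-prime p₂-prime 0<t₊ 0<t₋ t₊*t₋≡D t₊≢1 t₋≢1
  where
  3≤ : ∀ {p} → p ℕ.% 4 ≡ 3 → 3 ℕ.≤ p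
  3≤ {p} p%4≡3 = subst (ℕ._≤ p) p%4≡3 (ℕ.m%n≤m p 4)
  D≡4k+1 : + (p₁ ℕ.* p₂) ≡ + 4 * kD (p₁ ℕ.* p₂) + 1ℤ
  D≡4k+1 = ≡1-mod-4⇒≡4k+1 (p₁ ℕ.* p₂)
    (trans (ℕ.%-distribˡ-* p₁ p₂ 4) (cong₂ (λ a b → (a ℕ.* b) ℕ.% 4) p₁%4≡3 p₂%4≡3))
  5<D : 5 ℕ.< p₁ ℕ.* p₂
  5<D = ℕₚ.≤-trans (ℕₚ.m≤m+n 6 3) (ℕₚ.*-mono-≤ (3≤ {p₁} p₁%4≡3) (3≤ {p₂} p₂%4≡3))
  open FundamentalUnit D≡4k+1 5<D ε-fundamental Nε≡1
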